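{- For all positive integers $m,k$, $\alpha(m+k)\leq \alpha(m)+\alpha(k+1)$.
   Context: For a finite family $\mathcal{S}=\{S_1,\dots,S_t\}$ of finite sets, $\mathbf{ID}(\mathcal{S})=2^{S_1}\cup\cdots\cup 2^{S_t}$ (all sets contained in some member of $\mathcal{S}$). For a positive integer $k$, $\alpha(k)$ is the minimum of $|\mathcal{S}|$ over all finite families $\mathcal{S}$ of finite sets with $|\mathbf{ID}(\mathcal{S})|=k$. -}

module Defs where

open import Data.Nat using (ℕ; zero; suc; _≤_)
open import Data.Bool using (true; false)
open import Data.Vec using (_∷_; [])
open import Data.List using (List; length; filter; map; _++_; [_])
open import Data.List.Relation.Unary.Any using (Any; any?)
open import Data.List.Relation.Unary.Unique.Propositional using (Unique)
open import Data.Fin.Subset using (Subset; _⊆_)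
open import Data.Fin.Subset.Properties using (_⊆?_)
open import Data.Product using (Σ; _×_)
open import Relation.Binary.PropositionalEquality using (_≡_)

allSubsets : (n : ℕ) → List (Subset n)
allSubsets zero = [ [] ]
allSubsets (suc n) = map (false ∷_) (allSubsets n) ++ map (true ∷_) (allSubsets n)

ID : {n : ℕ} → List (Subset n) → List (Subset n)
ID {n} S = filter (λ T → any? (λ Si → T ⊆? Si) S) (allSubsets n)

Achievable : ℕ → ℕ → Set
Achievable k t = Σ ℕ λ n → Σ (List (Subset n)) λ S →
  Unique S × length S ≡ t × length (ID S) ≡ k

-- IsAlpha k a  :⇔  a = α(k), i.e. a is the minimum of |S| over families with |ID(S)| = k.
IsAlpha : ℕ → ℕ → Set
IsAlpha k a = Achievable k a × (∀ t → Achievable k t → a ≤ t)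

-- Take S over a ground set X with |ID(S)| = m and T over a disjoint ground set Y
-- with |ID(T)| = k + 1.  Over X ∪ Y, the sets of S together with the non-empty
-- sets of T form at most |S| + |T| distinct sets, whose ideal is ID(S) ∪ ID(T)
-- with the two parts sharing only the empty set; it therefore has m + k members.
module Submission where

open import Defs
open import Data.Nat using (ℕ; _+_; _*_; _≤_; suc; zero; NonZero)
open import Data.Nat.Properties
  using (+-comm; +-assoc; +-identityʳ; *-identityʳ; *-distribʳ-+; +-cancelʳ-≡;
         +-monoʳ-≤; +-commutativeSemigroup; module ≤-Reasoning)
open import Algebra.Properties.CommutativeSemigroup +-commutativeSemigroup using (xy∙z≈xz∙y)
open import Data.Bool using (Bool; true; false; _∧_; _∨_; if_then_else_)
open import Data.Bool.Properties using (∨-assoc; ∨-identityʳ; ∧-zeroʳ; ∧-distribʳ-∨; ∧-distribˡ-∨)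
open import Data.Vec using ([]; _∷_; _++_)
open import Data.Vec.Properties using (++-injectiveˡ; ++-injectiveʳ)
open import Data.List using (List; []; _∷_; length; filter; map) renaming (_++_ to _++ₗ_)
open import Data.List.Properties using (length-++; length-map; length-filter; filter-++)
open import Data.List.Relation.Unary.Any using (any?)
open import Data.List.Relation.Unary.Unique.Propositional using (Unique)
import Data.List.Relation.Unary.Unique.Propositional.Properties as Unique
open import Data.List.Relation.Binary.Disjoint.Propositional using (Disjoint)
open import Data.List.Membership.Propositional.Properties using (∈-map⁻; ∈-filter⁻)
open import Data.Fin.Subset using (Subset; _⊆_; _∈_; ⊥; outside; inside)
open import Data.Fin.Subset.Properties using (_⊆?_; ⊥⊆; ∉⊥; ⊆-trans; nonempty?; Empty-unique)
open import Data.Product using (_,_)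
open import Function using (_∘_)
open import Level using (Level)
open import Relation.Nullary using (does; yes; no; ¬_; contradiction)
open import Relation.Nullary.Decidable using (dec-true; dec-false)
open import Relation.Unary using (Pred; Decidable)
open import Relation.Binary.PropositionalEquality
  using (_≡_; refl; sym; trans; cong; cong₂; subst; module ≡-Reasoning)

private
  variable
    n p : ℕ

_⊆ᵇ_ : Subset n → Subset n → Bool
x ⊆ᵇ y = does (x ⊆? y)

inID : List (Subset n) → Subset n → Bool
inID S x = does (any? (x ⊆?_) S)

count : (N : ℕ) → (Subset N → Bool) → ℕ
count zero    f = if f [] then 1 else 0
count (suc N) f = count N (f ∘ (outside ∷_)) + count N (f ∘ (inside ∷_))

count-cong : {f g : Subset n → Bool} → (∀ x → f x ≡ g x) → count n f ≡ count n g
count-cong {zero}  f≗g = cong (λ b → if b then 1 else 0) (f≗g [])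
count-cong {suc n} f≗g = cong₂ _+_ (count-cong (f≗g ∘ (outside ∷_))) (count-cong (f≗g ∘ (inside ∷_)))

count-false : count n (λ _ → false) ≡ 0
count-false {zero}  = refl
count-false {suc n} = cong₂ _+_ (count-false {n}) (count-false {n})

count-empty : count n (_⊆ᵇ ⊥) ≡ 1
count-empty {zero}  = refl
count-empty {suc n} = cong₂ _+_ (count-empty {n}) (count-false {n})

count-const-∧ : (b : Bool) (g : Subset n → Bool) →
                count n (λ y → b ∧ g y) ≡ (if b then 1 else 0) * count n g
count-const-∧ true  g = sym (+-identityʳ _)
count-const-∧ {n} false g = count-false {n}

count-product : (h : Subset (n + p) → Bool) (f : Subset n → Bool) (g : Subset p → Bool) →
                (∀ x y → h (x ++ y) ≡ f x ∧ g y) → count (n + p) h ≡ count n f * count p g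
count-product {zero}  h f g split = trans (count-cong (split [])) (count-const-∧ (f []) g)
count-product {suc n} {p} h f g split = begin
    count (n + p) (h ∘ (outside ∷_)) + count (n + p) (h ∘ (inside ∷_))
  ≡⟨ cong₂ _+_ (count-product _ (f ∘ (outside ∷_)) g (split ∘ (outside ∷_)))
                (count-product _ (f ∘ (inside ∷_)) g (split ∘ (inside ∷_))) ⟩
    count n (f ∘ (outside ∷_)) * count p g + count n (f ∘ (inside ∷_)) * count p g
  ≡⟨ sym (*-distribʳ-+ (count p g) (count n (f ∘ (outside ∷_))) _) ⟩
    count (suc n) f * count p g
  ∎
  where open ≡-Reasoning

-- Inclusion–exclusion for two families of subsets meeting only in the empty set.
count-wedge : (h : Subset (n + p) → Bool) (f : Subset n → Bool) (g : Subset p → Bool) →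
              f ⊥ ≡ true → (∀ x y → h (x ++ y) ≡ (f x ∧ y ⊆ᵇ ⊥) ∨ (x ⊆ᵇ ⊥ ∧ g y)) →
              count (n + p) h + 1 ≡ count n f + count p (λ y → y ⊆ᵇ ⊥ ∨ g y)
count-wedge {zero} {p} h f g f⊥ split = begin
    count p h + 1             ≡⟨ cong (_+ 1) (count-cong (λ y → trans (split [] y)
                                   (cong (λ b → (b ∧ y ⊆ᵇ ⊥) ∨ g y) f⊥))) ⟩
    G + 1                     ≡⟨ +-comm G 1 ⟩
    1 + G                     ≡⟨ cong (λ b → (if b then 1 else 0) + G) (sym f⊥) ⟩
    count zero f + G
  ∎
  where
  open ≡-Reasoning
  G = count p (λ y → y ⊆ᵇ ⊥ ∨ g y)
count-wedge {suc n} {p} h f g f⊥ split = begin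
    (count (n + p) h₀ + count (n + p) h₁) + 1  ≡⟨ xy∙z≈xz∙y (count (n + p) h₀) _ 1 ⟩
    (count (n + p) h₀ + 1) + count (n + p) h₁  ≡⟨ cong₂ _+_ outside-part inside-part ⟩
    (count n f₀ + G) + count n f₁              ≡⟨ xy∙z≈xz∙y (count n f₀) G _ ⟩
    (count n f₀ + count n f₁) + G
  ∎
  where
  open ≡-Reasoning
  G = count p (λ y → y ⊆ᵇ ⊥ ∨ g y)
  h₀ = h ∘ (outside ∷_)
  h₁ = h ∘ (inside ∷_)
  f₀ = f ∘ (outside ∷_)
  f₁ = f ∘ (inside ∷_)
  outside-part : count (n + p) h₀ + 1 ≡ count n f₀ + G
  outside-part = count-wedge h₀ f₀ g f⊥ (split ∘ (outside ∷_))
  inside-part : count (n + p) h₁ ≡ count n f₁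
  inside-part = begin
    count (n + p) h₁            ≡⟨ count-product h₁ f₁ (_⊆ᵇ ⊥) (λ x y → trans (split (inside ∷ x) y) (∨-identityʳ _)) ⟩
    count n f₁ * count p (_⊆ᵇ ⊥) ≡⟨ cong (count n f₁ *_) (count-empty {p}) ⟩
    count n f₁ * 1               ≡⟨ *-identityʳ _ ⟩
    count n f₁                   ∎

filter-map : {A B : Set} {ℓ : Level} {P : Pred A ℓ} (P? : Decidable P) (g : B → A) (xs : List B) →
             filter P? (map g xs) ≡ map g (filter (P? ∘ g) xs)
filter-map P? g []       = refl
filter-map P? g (x ∷ xs) with does (P? (g x))
... | true  = cong (g x ∷_) (filter-map P? g xs)
... | false = filter-map P? g xs

length-filter-allSubsets : (N : ℕ) {ℓ : Level} {P : Pred (Subset N) ℓ} (P? : Decidable P) →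
                           length (filter P? (allSubsets N)) ≡ count N (does ∘ P?)
length-filter-allSubsets zero P? with does (P? [])
... | true  = refl
... | false = refl
length-filter-allSubsets (suc N) P? = begin
    length (filter P? (map (outside ∷_) Ss ++ₗ map (inside ∷_) Ss))
  ≡⟨ cong length (filter-++ P? (map (outside ∷_) Ss) _) ⟩
    length (filter P? (map (outside ∷_) Ss) ++ₗ filter P? (map (inside ∷_) Ss))
  ≡⟨ length-++ (filter P? (map (outside ∷_) Ss)) ⟩
    length (filter P? (map (outside ∷_) Ss)) + length (filter P? (map (inside ∷_) Ss))
  ≡⟨ cong₂ _+_ (half outside) (half inside) ⟩
    count (suc N) (does ∘ P?)
  ∎
  where
  open ≡-Reasoning
  Ss = allSubsets N
  half : ∀ b → length (filter P? (map (b ∷_) Ss)) ≡ count N (does ∘ P? ∘ (b ∷_))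
  half b = begin
    length (filter P? (map (b ∷_) Ss))       ≡⟨ cong length (filter-map P? (b ∷_) Ss) ⟩
    length (map (b ∷_) (filter (P? ∘ (b ∷_)) Ss)) ≡⟨ length-map (b ∷_) (filter (P? ∘ (b ∷_)) Ss) ⟩
    length (filter (P? ∘ (b ∷_)) Ss)          ≡⟨ length-filter-allSubsets N (P? ∘ (b ∷_)) ⟩
    count N (does ∘ P? ∘ (b ∷_))             ∎

length-ID : (S : List (Subset n)) → length (ID S) ≡ count n (inID S)
length-ID {n} S = length-filter-allSubsets n (λ x → any? (x ⊆?_) S)

⊆ᵇ-++ : (x s : Subset n) (y t : Subset p) → (x ++ y) ⊆ᵇ (s ++ t) ≡ x ⊆ᵇ s ∧ y ⊆ᵇ t
⊆ᵇ-++ []            []            y t = refl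
⊆ᵇ-++ (outside ∷ x) (_ ∷ s)       y t = ⊆ᵇ-++ x s y t
⊆ᵇ-++ (inside ∷ x)  (outside ∷ s) y t = refl
⊆ᵇ-++ (inside ∷ x)  (inside ∷ s)  y t = ⊆ᵇ-++ x s y t

inID-++ : (S T : List (Subset n)) (x : Subset n) → inID (S ++ₗ T) x ≡ inID S x ∨ inID T x
inID-++ []      T x = refl
inID-++ (s ∷ S) T x = trans (cong (x ⊆ᵇ s ∨_) (inID-++ S T x)) (sym (∨-assoc (x ⊆ᵇ s) _ _))

inID-map-++ʳ : (S : List (Subset n)) (t : Subset p) (x : Subset n) (y : Subset p) →
               inID (map (_++ t) S) (x ++ y) ≡ inID S x ∧ y ⊆ᵇ t
inID-map-++ʳ []      t x y = refl
inID-map-++ʳ (s ∷ S) t x y = begin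
    (x ++ y) ⊆ᵇ (s ++ t) ∨ inID (map (_++ t) S) (x ++ y)
  ≡⟨ cong₂ _∨_ (⊆ᵇ-++ x s y t) (inID-map-++ʳ S t x y) ⟩
    (x ⊆ᵇ s ∧ y ⊆ᵇ t) ∨ (inID S x ∧ y ⊆ᵇ t)
  ≡⟨ sym (∧-distribʳ-∨ (y ⊆ᵇ t) (x ⊆ᵇ s) _) ⟩
    inID (s ∷ S) x ∧ y ⊆ᵇ t
  ∎
  where open ≡-Reasoning

inID-map-++ˡ : (s : Subset n) (T : List (Subset p)) (x : Subset n) (y : Subset p) →
               inID (map (s ++_) T) (x ++ y) ≡ x ⊆ᵇ s ∧ inID T y
inID-map-++ˡ s []      x y = sym (∧-zeroʳ (x ⊆ᵇ s))
inID-map-++ˡ s (t ∷ T) x y = begin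
    (x ++ y) ⊆ᵇ (s ++ t) ∨ inID (map (s ++_) T) (x ++ y)
  ≡⟨ cong₂ _∨_ (⊆ᵇ-++ x s y t) (inID-map-++ˡ s T x y) ⟩
    (x ⊆ᵇ s ∧ y ⊆ᵇ t) ∨ (x ⊆ᵇ s ∧ inID T y)
  ≡⟨ sym (∧-distribˡ-∨ (x ⊆ᵇ s) (y ⊆ᵇ t) _) ⟩
    x ⊆ᵇ s ∧ inID (t ∷ T) y
  ∎
  where open ≡-Reasoning

dropEmpty : List (Subset n) → List (Subset n)
dropEmpty = filter nonempty?

inID-dropEmpty-nonempty : (T : List (Subset n)) {y : Subset n} → ¬ y ⊆ ⊥ →
                          inID (dropEmpty T) y ≡ inID T y
inID-dropEmpty-nonempty []      y⊈⊥ = refl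
inID-dropEmpty-nonempty (t ∷ T) {y} y⊈⊥ with nonempty? t
... | yes _     = cong (y ⊆ᵇ t ∨_) (inID-dropEmpty-nonempty T y⊈⊥)
... | no  empty = begin
    inID (dropEmpty T) y      ≡⟨ inID-dropEmpty-nonempty T y⊈⊥ ⟩
    inID T y                  ≡⟨ cong (_∨ inID T y) (sym y⊈t) ⟩
    y ⊆ᵇ t ∨ inID T y         ∎
  where
  open ≡-Reasoning
  y⊈t : y ⊆ᵇ t ≡ false
  y⊈t = dec-false (y ⊆? t) (y⊈⊥ ∘ subst (y ⊆_) (Empty-unique empty))

inID-dropEmpty : (t : Subset n) (T : List (Subset n)) (y : Subset n) →
                 inID (t ∷ T) y ≡ y ⊆ᵇ ⊥ ∨ inID (dropEmpty (t ∷ T)) y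
inID-dropEmpty t T y with y ⊆? ⊥
... | yes y⊆⊥ = cong (_∨ inID T y) (dec-true (y ⊆? t) (⊆-trans y⊆⊥ ⊥⊆))
... | no  y⊈⊥ = sym (inID-dropEmpty-nonempty (t ∷ T) y⊈⊥)

disjointUnion : List (Subset n) → List (Subset p) → List (Subset (n + p))
disjointUnion S T = map (_++ ⊥) S ++ₗ map (⊥ ++_) (dropEmpty T)

disjointUnion-unique : (S : List (Subset n)) (T : List (Subset p)) →
                       Unique S → Unique T → Unique (disjointUnion S T)
disjointUnion-unique {n} S T uS uT =
  Unique.++⁺ (Unique.map⁺ (λ {x} {y} → ++-injectiveˡ x y) uS)
             (Unique.map⁺ (++-injectiveʳ ⊥ ⊥) (Unique.filter⁺ nonempty? uT))
             separated
  where
  separated : Disjoint (map (_++ ⊥) S) (map (⊥ ++_) (dropEmpty T))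
  separated (v∈S , v∈T) with ∈-map⁻ (_++ ⊥) v∈S | ∈-map⁻ (⊥ ++_) v∈T
  ... | s , _ , refl | t , t∈T , s++⊥≡⊥++t with ∈-filter⁻ nonempty? {xs = T} t∈T
  ... | _ , (i , i∈t) = ∉⊥ (subst (i ∈_) (sym (++-injectiveʳ s ⊥ s++⊥≡⊥++t)) i∈t)

length-disjointUnion : (S : List (Subset n)) (T : List (Subset p)) →
                       length (disjointUnion S T) ≤ length S + length T
length-disjointUnion S T = begin
  length (disjointUnion S T)                          ≡⟨ length-++ (map (_++ ⊥) S) ⟩
  length (map (_++ ⊥) S) + length (map (⊥ ++_) (dropEmpty T))
                                                      ≡⟨ cong₂ _+_ (length-map _ S) (length-map _ (dropEmpty T)) ⟩
  length S + length (dropEmpty T)                     ≤⟨ +-monoʳ-≤ (length S) (length-filter nonempty? T) ⟩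
  length S + length T                                 ∎
  where open ≤-Reasoning

length-ID-disjointUnion : (s : Subset n) (S : List (Subset n)) (t : Subset p) (T : List (Subset p)) →
                          length (ID (disjointUnion (s ∷ S) (t ∷ T))) + 1 ≡ length (ID (s ∷ S)) + length (ID (t ∷ T))
length-ID-disjointUnion {n} {p} s S t T = begin
    length (ID U) + 1
  ≡⟨ cong (_+ 1) (length-ID U) ⟩
    count (n + p) (inID U) + 1
  ≡⟨ count-wedge (inID U) (inID (s ∷ S)) (inID T′) ⊥∈ID split ⟩
    count n (inID (s ∷ S)) + count p (λ y → y ⊆ᵇ ⊥ ∨ inID T′ y)
  ≡⟨ cong₂ _+_ (sym (length-ID (s ∷ S))) (count-cong (λ y → sym (inID-dropEmpty t T y))) ⟩
    length (ID (s ∷ S)) + count p (inID (t ∷ T))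
  ≡⟨ cong (length (ID (s ∷ S)) +_) (sym (length-ID (t ∷ T))) ⟩
    length (ID (s ∷ S)) + length (ID (t ∷ T))
  ∎
  where
  open ≡-Reasoning
  T′ = dropEmpty (t ∷ T)
  U = disjointUnion (s ∷ S) (t ∷ T)
  ⊥∈ID : inID (s ∷ S) ⊥ ≡ true
  ⊥∈ID = cong (_∨ inID S ⊥) (dec-true (⊥ ⊆? s) ⊥⊆)
  split : ∀ x y → inID U (x ++ y) ≡ (inID (s ∷ S) x ∧ y ⊆ᵇ ⊥) ∨ (x ⊆ᵇ ⊥ ∧ inID T′ y)
  split x y = trans (inID-++ (map (_++ ⊥) (s ∷ S)) _ (x ++ y))
                    (cong₂ _∨_ (inID-map-++ʳ (s ∷ S) ⊥ x y) (inID-map-++ˡ ⊥ T′ x y))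

length-ID-[] : (n : ℕ) → length (ID {n} []) ≡ 0
length-ID-[] n = trans (length-ID {n} []) (count-false {n})

lemma18 : (m k : ℕ) → .{{NonZero m}} → .{{NonZero k}} →
          (a b c : ℕ) → IsAlpha (m + k) a → IsAlpha m b → IsAlpha (k + 1) c →
          a ≤ b + c
lemma18 (suc m) (suc k) a b c _ ((n , [] , _ , _ , ID≡m) , _) _ =
  contradiction (trans (sym (length-ID-[] n)) ID≡m) λ ()
lemma18 (suc m) (suc k) a b c _ _ ((p , [] , _ , _ , ID≡k+1) , _) =
  contradiction (trans (sym (length-ID-[] p)) (trans ID≡k+1 (+-comm (suc k) 1))) λ ()
lemma18 (suc m) (suc k) a b c (_ , a-minimal)
        ((n , s ∷ S , uS , ∣S∣≡b , ID≡m) , _) ((p , t ∷ T , uT , ∣T∣≡c , ID≡k+1) , _) = begin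
  a                       ≤⟨ a-minimal _ (n + p , U , disjointUnion-unique (s ∷ S) (t ∷ T) uS uT , refl , ID≡m+k) ⟩
  length U                ≤⟨ length-disjointUnion (s ∷ S) (t ∷ T) ⟩
  length (s ∷ S) + length (t ∷ T) ≡⟨ cong₂ _+_ ∣S∣≡b ∣T∣≡c ⟩
  b + c                   ∎
  where
  open ≤-Reasoning
  U = disjointUnion (s ∷ S) (t ∷ T)
  ID≡m+k : length (ID U) ≡ suc m + suc k
  ID≡m+k = +-cancelʳ-≡ _ _ _ (begin-equality
    length (ID U) + 1                              ≡⟨ length-ID-disjointUnion s S t T ⟩
    length (ID (s ∷ S)) + length (ID (t ∷ T))      ≡⟨ cong₂ _+_ ID≡m ID≡k+1 ⟩
    suc m + (suc k + 1)                            ≡⟨ sym (+-assoc (suc m) (suc k) 1) ⟩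
    suc m + suc k + 1                              ∎)
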